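{- Fix an integer $k \ge 3$. Let $f:\mathbb{Z}_{>0}\to\mathbb{C}$ be a multiplicative function such that \[ f(a_1^2 + a_2^2 + \dotsb + a_k^2) = f(a_1^2) + f(a_2^2) + \dotsb + f(a_k^2) \] for all positive integers $a_1,\dots,a_k$. Then $f(n)=n$ for all positive integers $n$. (In the paper's terminology: the set of positive squares is a $k$-additive uniqueness set for multiplicative functions.)
   Context: A function $f$ on the positive integers is multiplicative if $f(1)=1$ and $f(mn)=f(m)f(n)$ whenever $\gcd(m,n)=1$. A set $E$ is called a $k$-additive uniqueness set for a class $S$ of arithmetic functions if the only $f\in S$ satisfying $f(e_1+\dots+e_k)=f(e_1)+\dots+f(e_k)$ for all $e_1,\dots,e_k\in E$ is the identity function. -}

module Defs where

open import Level using (Level)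
import Data.Nat as ℕ
open ℕ using (ℕ; zero; suc; _≤_)
open import Data.Nat.Coprimality using (Coprime)
open import Data.Fin using (Fin; zero; suc)
open import Data.Product using (_×_)
open import Data.Sum using (_⊎_)
open import Data.Empty using (⊥)
open import Algebra.Bundles using (CommutativeRing)

sumℕ : (k : ℕ) → (Fin k → ℕ) → ℕ
sumℕ zero    g = 0
sumℕ (suc k) g = g zero ℕ.+ sumℕ k (λ i → g (suc i))

module _ {c ℓ : Level} (R : CommutativeRing c ℓ) where
  open CommutativeRing R using (Carrier; _≈_; _+_; _*_; 0#; 1#)

  sumR : (k : ℕ) → (Fin k → Carrier) → Carrier
  sumR zero    g = 0#
  sumR (suc k) g = g zero + sumR k (λ i → g (suc i))

  natCast : ℕ → Carrier
  natCast zero    = 0#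
  natCast (suc n) = 1# + natCast n

  CharZero : Set ℓ
  CharZero = ∀ n → natCast (suc n) ≈ 0# → ⊥

  NoZeroDivisors : Set (c Level.⊔ ℓ)
  NoZeroDivisors = ∀ x y → x * y ≈ 0# → (x ≈ 0#) ⊎ (y ≈ 0#)

  Nontrivial : Set ℓ
  Nontrivial = 1# ≈ 0# → ⊥

  -- f : ℕ → R, with only values at positive integers meaningful, is multiplicative.
  Multiplicative : (ℕ → Carrier) → Set ℓ
  Multiplicative f =
    (f 1 ≈ 1#) ×
    (∀ m n → 1 ≤ m → 1 ≤ n → Coprime m n → f (m ℕ.* n) ≈ f m * f n)

module Submission where

open import Defs
open import Level using (Level)
open import Data.Nat using (ℕ; _≤_; _^_)
open import Data.Fin using (Fin)
open import Algebra.Bundles using (CommutativeRing)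

-- Part A determines F n = f (n²).  Padding with 1² = 1 turns additivity into: lists of
-- the same length ≤ k with equal sums of squares have equal sums of F.  A chain of
-- three-term identities gives F n = 1 + e (n² − 1)/8 for odd n ≤ 15, where
-- e = F 3 − 1, and F 15 = F 3 · F 5 forces e ∈ {0, 8}.  Two families of identities
-- determine F from F 1, …, F 4 by strong induction; e = 8 yields F n = n², while e = 0
-- contradicts characteristic zero.
-- Part B proves f n = n by strong induction along the prime factorisation.  Even prime
-- powers are squares.  For p^(2t+1), a pigeonhole argument on squares modulo p writes
-- m p with 0 < m < p (so m is already known) as a sum of at most k squares; scaling by
-- a square Q² coprime to it, built from Pythagorean triples, gives a sum of exactly k
-- squares, and multiplicativity isolates f (p^(2t+1)).

module Arithmetic where

  open import Data.Nat
  open import Data.Nat.Properties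
  open import Data.Nat.Divisibility
  open import Data.Nat.DivMod
  open import Data.Nat.Primality
  open import Data.Nat.Coprimality as Coprimality using (Coprime)
  open import Data.Nat.Primality.Factorisation using (factorise)
  open import Data.Nat.ListAction using (product)
  open import Data.Nat.Induction using (<-rec)
  open import Data.Nat.Tactic.RingSolver using (solve-∀)
  open import Data.Fin as Fin using (toℕ; fromℕ<)
  import Data.Fin.Properties as Finₚ
  open import Data.List using ([]; _∷_)
  open import Data.List.Relation.Unary.All using (_∷_)
  open import Data.Product using (Σ; ∃-syntax; _×_; _,_)
  open import Data.Sum using (_⊎_; inj₁; inj₂)
  open import Data.Empty using (⊥; ⊥-elim)
  open import Relation.Nullary using (¬_; Dec; yes; no)
  open import Relation.Binary.PropositionalEquality
  open ≡-Reasoning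

  evenOrOdd : ∀ n → Σ ℕ λ t → (n ≡ t + t) ⊎ (n ≡ suc (t + t))
  evenOrOdd zero = 0 , inj₁ refl
  evenOrOdd (suc n) with evenOrOdd n
  ... | t , inj₁ e = t , inj₂ (cong suc e)
  ... | t , inj₂ e = suc t , inj₁ (cong suc (trans e (sym (+-suc t t))))

  prime≥2 : ∀ {p} → Prime p → 2 ≤ p
  prime≥2 {p} pp = nonTrivial⇒n>1 p {{prime⇒nonTrivial pp}}

  oddPrime : ∀ {p} → Prime p → 2 < p → Σ ℕ λ h → p ≡ suc (h + h)
  oddPrime {p} pp 2<p with evenOrOdd p
  ... | h , inj₂ p≡2h+1 = h , p≡2h+1
  ... | h , inj₁ p≡2h with prime⇒irreducible pp (divides h (trans p≡2h (double≡*2 h)))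
    where
    double≡*2 : ∀ h → h + h ≡ h * 2
    double≡*2 = solve-∀
  ... | inj₁ ()
  ... | inj₂ 2≡p = ⊥-elim (<⇒≢ 2<p 2≡p)

  positive-* : ∀ {a b} → 1 ≤ a → 1 ≤ b → 1 ≤ a * b
  positive-* {suc a} {suc b} _ _ = s≤s z≤n

  positive-factorˡ : ∀ a b → 1 ≤ a * b → 1 ≤ a
  positive-factorˡ (suc a) b _ = s≤s z≤n

  positive-factorʳ : ∀ a b → 1 ≤ a * b → 1 ≤ b
  positive-factorʳ a b 1≤ab = positive-factorˡ b a (subst (1 ≤_) (*-comm a b) 1≤ab)

  positive-^ : ∀ {a} → 1 ≤ a → ∀ t → 1 ≤ a ^ t
  positive-^ 1≤a zero = s≤s z≤n
  positive-^ 1≤a (suc t) = positive-* 1≤a (positive-^ 1≤a t)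

  primeFactor : ∀ n → 2 ≤ n → ∃[ p ] (Prime p × p ∣ n)
  primeFactor n@(suc _) 2≤n with factorise n
  ... | record { factors = [] ; isFactorisation = n≡1 } = ⊥-elim (<⇒≢ 2≤n (sym n≡1))
  ... | record { factors = p ∷ ps ; isFactorisation = n≡p*ps ; factorsPrime = pp ∷ _ } =
    p , pp , divides (product ps) (trans n≡p*ps (*-comm p (product ps)))

  primePowerPart : ∀ {p} → Prime p → ∀ n → 1 ≤ n →
    ∃[ e ] ∃[ r ] (n ≡ p ^ e * r × ¬ p ∣ r)
  primePowerPart {p} pp = <-rec _ split
    where
    split : ∀ n → (∀ {m} → m < n → 1 ≤ m → ∃[ e ] ∃[ r ] (m ≡ p ^ e * r × ¬ p ∣ r)) →
            1 ≤ n → ∃[ e ] ∃[ r ] (n ≡ p ^ e * r × ¬ p ∣ r)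
    split n rec 1≤n with p ∣? n
    ... | no p∤n = 0 , n , sym (+-identityʳ n) , p∤n
    ... | yes (divides zero n≡0) = ⊥-elim (<⇒≱ 1≤n (≤-reflexive n≡0))
    ... | yes (divides q@(suc _) n≡qp)
        with rec (subst (q <_) (sym n≡qp) (m<m*n q p (prime≥2 pp))) (s≤s z≤n)
    ... | e , r , q≡pᵉr , p∤r =
      suc e , r , trans n≡qp (trans (cong (_* p) q≡pᵉr) (rearrange (p ^ e) r p)) , p∤r
      where
      rearrange : ∀ a r p → a * r * p ≡ p * a * r
      rearrange = solve-∀

  primeFreePart< : ∀ {p n e r} → Prime p → p ∣ n → 1 ≤ n → n ≡ p ^ e * r → ¬ p ∣ r → r < n
  primeFreePart< {p} {n} {zero} {r} pp p∣n 1≤n n≡r p∤r =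
    ⊥-elim (p∤r (subst (p ∣_) (trans n≡r (+-identityʳ r)) p∣n))
  primeFreePart< {p} {n} {suc e} {r} pp p∣n 1≤n n≡pᵉr p∤r =
    subst (r <_) (sym (trans n≡pᵉr (*-comm (p ^ suc e) r)))
      (m<m*n r (p ^ suc e) {{>-nonZero 1≤r}} (^-monoʳ-< p (prime≥2 pp) {0} {suc e} z<s))
    where
    1≤r : 1 ≤ r
    1≤r = positive-factorʳ (p ^ suc e) r (subst (1 ≤_) n≡pᵉr 1≤n)

  coprime-* : ∀ {a b n} → Coprime a n → Coprime b n → Coprime (a * b) n
  coprime-* {a} {b} {n} a⊥n b⊥n (d∣ab , d∣n) = b⊥n (d∣b , d∣n)
    where
    d⊥a : Coprime _ a
    d⊥a (c∣d , c∣a) = a⊥n (c∣a , ∣-trans c∣d d∣n)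
    d∣b = Coprimality.coprime-divisor d⊥a d∣ab

  coprime-^ : ∀ {a n} → Coprime a n → ∀ e → Coprime (a ^ e) n
  coprime-^ {a} {n} a⊥n zero = Coprimality.1-coprimeTo n
  coprime-^ {a} {n} a⊥n (suc e) = coprime-* a⊥n (coprime-^ a⊥n e)

  coprime-∣ : ∀ {a n d} → Coprime a n → d ∣ n → Coprime a d
  coprime-∣ a⊥n d∣n (c∣a , c∣d) = a⊥n (c∣a , ∣-trans c∣d d∣n)

  prime-coprime : ∀ {p r} → Prime p → ¬ p ∣ r → Coprime p r
  prime-coprime pp p∤r (d∣p , d∣r) with prime⇒irreducible pp d∣p
  ... | inj₁ d≡1 = d≡1
  ... | inj₂ refl = ⊥-elim (p∤r d∣r)

  ∣∸-of-%≡ : ∀ a b p .{{_ : NonZero p}} → a ≤ b → a % p ≡ b % p → p ∣ b ∸ a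
  ∣∸-of-%≡ a b p a≤b a≡b = divides (b / p ∸ a / p) (begin
      b ∸ a
    ≡⟨ cong₂ _∸_ (m≡m%n+[m/n]*n b p) (m≡m%n+[m/n]*n a p) ⟩
      (b % p + (b / p) * p) ∸ (a % p + (a / p) * p)
    ≡⟨ cong (λ z → (b % p + (b / p) * p) ∸ (z + (a / p) * p)) a≡b ⟩
      (b % p + (b / p) * p) ∸ (b % p + (a / p) * p)
    ≡⟨ [m+n]∸[m+o]≡n∸o (b % p) _ _ ⟩
      (b / p) * p ∸ (a / p) * p
    ≡⟨ sym (*-distribʳ-∸ p (b / p) (a / p)) ⟩
      (b / p ∸ a / p) * p ∎)

  ∣-between-0-and-p : ∀ {p d} → p ∣ d → 0 < d → d < p → ⊥
  ∣-between-0-and-p {p} {suc d} p∣d _ d<p = <⇒≱ d<p (∣⇒≤ p∣d)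

  -- Squares of x < y with x + y < p are distinct modulo the prime p,
  -- since y² − x² = (y − x)(y + x) and both factors lie strictly between 0 and p.
  squaresDistinct : ∀ {p} → Prime p → ∀ x y → x < y → y + x < p → ¬ p ∣ y * y ∸ x * x
  squaresDistinct {p} pp x y x<y y+x<p p∣y²-x²
    with euclidsLemma (y ∸ x) (y + x) pp (subst (p ∣_) difference-of-squares p∣y²-x²)
    where
    square-of-sum : ∀ x d → (x + d) * (x + d) ≡ x * x + d * ((x + d) + x)
    square-of-sum = solve-∀
    difference-of-squares : y * y ∸ x * x ≡ (y ∸ x) * (y + x)
    difference-of-squares = begin
      y * y ∸ x * x                                  ≡⟨ cong (λ z → z * z ∸ x * x) (sym y≡x+d) ⟩
      (x + (y ∸ x)) * (x + (y ∸ x)) ∸ x * x          ≡⟨ cong (_∸ x * x) (square-of-sum x (y ∸ x)) ⟩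
      x * x + (y ∸ x) * ((x + (y ∸ x)) + x) ∸ x * x  ≡⟨ m+n∸m≡n (x * x) _ ⟩
      (y ∸ x) * ((x + (y ∸ x)) + x)                  ≡⟨ cong (λ z → (y ∸ x) * (z + x)) y≡x+d ⟩
      (y ∸ x) * (y + x) ∎
      where y≡x+d = m+[n∸m]≡n (<⇒≤ x<y)
  ... | inj₁ p∣y-x = ∣-between-0-and-p p∣y-x (m<n⇒0<n∸m x<y)
                       (≤-<-trans (m∸n≤m y x) (≤-<-trans (m≤m+n y x) y+x<p))
  ... | inj₂ p∣y+x = ∣-between-0-and-p p∣y+x (<-≤-trans (≤-<-trans z≤n x<y) (m≤m+n y x)) y+x<p

  -- For an odd prime p = 2h + 1 and any c, the congruence x² + y² + c ≡ 0 (mod p)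
  -- has a solution with x, y ≤ h.  The h + 1 values x² and the h + 1 values
  -- −(y² + c) = 2h (y² + c) cannot all be distinct modulo p (pigeonhole on
  -- p + 1 values), and within each family they are distinct by squaresDistinct.
  module SquaresModPrime (h c : ℕ) where

    p : ℕ
    p = suc (h + h)

    Solution : Set
    Solution = ∃[ x ] ∃[ y ] (x ≤ h × y ≤ h × p ∣ x * x + (y * y + c))

    -- The value attached to i ∈ {0, …, p}: i² for i ≤ h, −((i − h − 1)² + c) otherwise.
    value : (i : ℕ) → Dec (i ≤ h) → ℕ
    value i (yes _) = i * i
    value i (no _)  = (h + h) * ((i ∸ suc h) * (i ∸ suc h) + c)

    -- x² ≡ 2h·Y (mod p) means x² + Y ≡ (2h + 1)·Y ≡ 0.
    square≡minus : ∀ x Y → (x * x) % p ≡ ((h + h) * Y) % p → p ∣ x * x + Y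
    square≡minus x Y x²≡-Y = m%n≡0⇒n∣m _ p (begin
        (x * x + Y) % p                     ≡⟨ %-distribˡ-+ (x * x) Y p ⟩
        ((x * x) % p + Y % p) % p           ≡⟨ cong (λ z → (z + Y % p) % p) x²≡-Y ⟩
        (((h + h) * Y) % p + Y % p) % p     ≡⟨ sym (%-distribˡ-+ ((h + h) * Y) Y p) ⟩
        ((h + h) * Y + Y) % p               ≡⟨ cong (_% p) (times-p h Y) ⟩
        (Y * p) % p                         ≡⟨ m*n%n≡0 Y p ⟩
        0 ∎)
      where
      times-p : ∀ h Y → (h + h) * Y + Y ≡ Y * suc (h + h)
      times-p = solve-∀

    shifted≤h : ∀ i → i < suc p → i ∸ suc h ≤ h
    shifted≤h i i≤p = ≤-trans (∸-monoˡ-≤ (suc h) (<⇒≤pred i≤p)) (≤-reflexive (m+n∸m≡n h h))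

    -- For h ≥ 1 the values −(y² + c) with y ≤ h are distinct modulo p: p ∤ 2h, and
    -- the squares y² are distinct by squaresDistinct.
    shiftedDistinct : Prime p → 0 < h + h → ∀ y y′ → y < y′ → y′ ≤ h →
      ¬ p ∣ (h + h) * (y′ * y′ + c) ∸ (h + h) * (y * y + c)
    shiftedDistinct pp 0<2h y y′ y<y′ y′≤h p∣-Y+Y′
      with euclidsLemma (h + h) _ pp (subst (p ∣_) factor p∣-Y+Y′)
      where
      factor : (h + h) * (y′ * y′ + c) ∸ (h + h) * (y * y + c) ≡ (h + h) * (y′ * y′ ∸ y * y)
      factor = trans (sym (*-distribˡ-∸ (h + h) _ _))
        (cong ((h + h) *_) (trans (cong₂ _∸_ (+-comm (y′ * y′) c) (+-comm (y * y) c))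
                                  ([m+n]∸[m+o]≡n∸o c _ _)))
    ... | inj₁ p∣2h = ∣-between-0-and-p p∣2h 0<2h (n<1+n _)
    ... | inj₂ p∣y′²-y² =
      squaresDistinct pp y y′ y<y′ (s≤s (+-mono-≤ y′≤h (≤-trans (<⇒≤ y<y′) y′≤h))) p∣y′²-y²

    collision : Prime p → ∀ i j → i < j → j < suc p → (di : Dec (i ≤ h)) (dj : Dec (j ≤ h)) →
                value i di % p ≡ value j dj % p → Solution
    collision pp i j i<j j≤p (yes i≤h) (yes j≤h) i²≡j² = ⊥-elim
      (squaresDistinct pp i j i<j (s≤s (+-mono-≤ j≤h i≤h))
        (∣∸-of-%≡ (i * i) (j * j) p (*-mono-≤ (<⇒≤ i<j) (<⇒≤ i<j)) i²≡j²))
    collision pp i j i<j j≤p (yes i≤h) (no _) i²≡-Y =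
      i , j ∸ suc h , i≤h , shifted≤h j j≤p , square≡minus i _ i²≡-Y
    collision pp i j i<j j≤p (no i≰h) (yes j≤h) _ = ⊥-elim (i≰h (≤-trans (<⇒≤ i<j) j≤h))
    collision pp i j i<j j≤p (no i≰h) (no _) -Y≡-Y′ =
      ⊥-elim (shiftedDistinct pp 0<2h y y′ y<y′ (shifted≤h j j≤p) (∣∸-of-%≡ _ _ p Y≤Y′ -Y≡-Y′))
      where
      y = i ∸ suc h
      y′ = j ∸ suc h
      y<y′ : y < y′
      y<y′ = ∸-monoˡ-< i<j (≰⇒> i≰h)
      Y≤Y′ : (h + h) * (y * y + c) ≤ (h + h) * (y′ * y′ + c)
      Y≤Y′ = *-monoʳ-≤ (h + h) (+-monoˡ-≤ c (*-mono-≤ (<⇒≤ y<y′) (<⇒≤ y<y′)))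
      0<2h : 0 < h + h
      0<2h = ≤-trans (s≤s z≤n) (s≤s⁻¹ (≤-trans (s≤s (≰⇒> i≰h)) (≤-trans i<j (<⇒≤pred j≤p))))

    residue : Fin (suc p) → Fin p
    residue i = fromℕ< (m%n<n (value (toℕ i) (toℕ i ≤? h)) p)

    solution : Prime p → Solution
    solution pp with Finₚ.pigeonhole (n<1+n p) residue
    ... | i , j , i<j , same =
      collision pp (toℕ i) (toℕ j) i<j (Finₚ.toℕ<n j) (toℕ i ≤? h) (toℕ j ≤? h)
        (trans (sym (Finₚ.toℕ-fromℕ< _)) (trans (cong toℕ same) (Finₚ.toℕ-fromℕ< _)))

  -- Descent step: for a prime p > k ≥ 3 some multiple m·p with 0 < m < p is a sum
  -- x² + y² + (k − 2) (i.e. of at most k positive squares, the last k − 2 being 1).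
  smallMultipleAsSquares : ∀ {p} k → Prime p → 3 ≤ k → k < p →
    ∃[ x ] ∃[ y ] ∃[ m ] (x * x + (y * y + (k ∸ 2)) ≡ m * p × 0 < m × m < p)
  smallMultipleAsSquares {p} k pp 3≤k k<p
    with oddPrime pp (<-≤-trans (s≤s (s≤s (s≤s z≤n))) (≤-trans 3≤k (<⇒≤ k<p)))
  ... | h , refl with SquaresModPrime.solution h (k ∸ 2) pp
  ... | x , y , x≤h , y≤h , divides m N≡mp = x , y , m , N≡mp , 0<m , m<p
    where
    N = x * x + (y * y + (k ∸ 2))
    0<m : 0 < m
    0<m = positive-factorˡ m (suc (h + h)) (subst (1 ≤_) N≡mp
            (≤-trans (∸-monoˡ-≤ 2 3≤k) (≤-trans (m≤n+m (k ∸ 2) (y * y)) (m≤n+m _ (x * x)))))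
    M = h * h + (h * h + (h + h))
    N≤M : N ≤ M
    N≤M = +-mono-≤ (*-mono-≤ x≤h x≤h) (+-mono-≤ (*-mono-≤ y≤h y≤h)
            (≤-trans (∸-monoˡ-≤ 2 (<⇒≤pred k<p)) (m∸n≤m (h + h) 2)))
    p²≡2M+1 : ∀ h → suc (h + h) * suc (h + h) ≡ suc ((h * h + (h * h + (h + h))) + (h * h + (h * h + (h + h))))
    p²≡2M+1 = solve-∀
    mp<p² : m * suc (h + h) < suc (h + h) * suc (h + h)
    mp<p² = subst (_< suc (h + h) * suc (h + h)) N≡mp
              (≤-<-trans N≤M (subst (M <_) (sym (p²≡2M+1 h)) (s≤s (m≤m+n M M))))
    m<p : m < suc (h + h)
    m<p = *-cancelʳ-< _ m (suc (h + h)) mp<p²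

  oddIdentity : ∀ t → (7 + (t + t)) * (7 + (t + t)) + ((1 + t) * (1 + t) + 1)
                    ≡ (5 + (t + t)) * (5 + (t + t)) + ((5 + t) * (5 + t) + 1)
  oddIdentity = solve-∀

  evenIdentity : ∀ t → (12 + (t + t)) * (12 + (t + t)) + ((1 + t) * (1 + t) + 1)
                     ≡ (8 + (t + t)) * (8 + (t + t)) + ((9 + t) * (9 + t) + 1)
  evenIdentity = solve-∀

  oddShift : ∀ t → 12 + suc (t + t) ≡ 7 + ((3 + t) + (3 + t))
  oddShift = solve-∀

  twoApart : ∀ i → (1 + i) * (1 + i) + (2 + i) * 4 ≡ (3 + i) * (3 + i)
  twoApart = solve-∀

  twoApart′ : ∀ i → (1 + i) * (1 + i) + (4 + (1 + i) * 4) ≡ (3 + i) * (3 + i)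
  twoApart′ = solve-∀

  scaleSquare : ∀ s a r → (s * a) * (s * a) + s * s * r ≡ s * s * (a * a + r)
  scaleSquare = solve-∀

  splitSquare : ∀ U V H a r → H * H ≡ U * U + V * V →
    (U * a) * (U * a) + ((V * a) * (V * a) + H * H * r) ≡ H * H * (a * a + r)
  splitSquare U V H a r H²≡U²+V² = begin
    (U * a) * (U * a) + ((V * a) * (V * a) + H * H * r) ≡⟨ expand U V H a r ⟩
    (U * U + V * V) * (a * a) + H * H * r              ≡⟨ cong (λ z → z * (a * a) + H * H * r) H²≡U²+V² ⟨
    H * H * (a * a) + H * H * r                        ≡⟨ *-distribˡ-+ (H * H) (a * a) r ⟨
    H * H * (a * a + r) ∎
    where
    expand : ∀ U V H a r → (U * a) * (U * a) + ((V * a) * (V * a) + H * H * r)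
                          ≡ (U * U + V * V) * (a * a) + H * H * r
    expand = solve-∀

  oddPowerSquare : ∀ p t m → p ^ t * p ^ t * (p * m) ≡ p ^ suc (t + t) * m
  oddPowerSquare p t m = begin
    p ^ t * p ^ t * (p * m)   ≡⟨ regroup (p ^ t) p m ⟩
    p * (p ^ t * p ^ t) * m   ≡⟨ cong (λ z → p * z * m) (^-distribˡ-+-* p t t) ⟨
    p ^ suc (t + t) * m ∎
    where
    regroup : ∀ a p m → a * a * (p * m) ≡ p * (a * a) * m
    regroup = solve-∀

  -- For every N ≥ 1 there is a Pythagorean triple H² = U² + V² with U, V, H ≥ 1 and
  -- H coprime to N: take H = 4N² + 1, U = 4N² − 1, V = 4N.
  coprimePythagoreanTriple : ∀ N → 1 ≤ N →
    ∃[ U ] ∃[ V ] ∃[ H ] (H * H ≡ U * U + V * V × 1 ≤ U × 1 ≤ V × 1 ≤ H × Coprime H N)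
  coprimePythagoreanTriple (suc n) _ = U , V , H , pythagoras n , s≤s z≤n , s≤s z≤n , s≤s z≤n , H⊥N
    where
    U = 3 + 8 * n + 4 * (n * n)
    V = 4 + 4 * n
    H = 5 + 8 * n + 4 * (n * n)
    pythagoras : ∀ n → (5 + 8 * n + 4 * (n * n)) * (5 + 8 * n + 4 * (n * n)) ≡
      (3 + 8 * n + 4 * (n * n)) * (3 + 8 * n + 4 * (n * n)) + (4 + 4 * n) * (4 + 4 * n)
    pythagoras = solve-∀
    H≡4N²+1 : ∀ n → 5 + 8 * n + 4 * (n * n) ≡ 4 * (suc n * suc n) + 1
    H≡4N²+1 = solve-∀
    H⊥N : Coprime H (suc n)
    H⊥N {d} (d∣H , d∣N) =
      ∣1⇒≡1 (∣m+n∣m⇒∣n (subst (d ∣_) (H≡4N²+1 n) d∣H) (∣n⇒∣m*n 4 (∣m⇒∣m*n (suc n) d∣N)))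

module IntegralDomain {c ℓ : Level} (R : CommutativeRing c ℓ)
  (noZeroDivisors : NoZeroDivisors R) (charZero : CharZero R) where

  import Data.Nat as Nat
  open Nat using (zero; suc)
  open import Data.Sum using (_⊎_; inj₁; inj₂)
  open import Data.Empty using (⊥-elim)
  open import Relation.Nullary using (¬_)
  open import Relation.Binary.PropositionalEquality as ≡ using (_≡_)
  open CommutativeRing R
  open import Relation.Binary.Reasoning.Setoid setoid
  open import Algebra.Properties.Ring ring public
    using (+-cancelˡ; +-cancelʳ; x∙y⁻¹≈ε⇒x≈y; x[y-z]≈xy-xz; [y-z]x≈yx-zx)
  open import Algebra.Properties.Semiring.Mult semiring using (_×_; ×-homo-+; ×1-homo-*)
  open import Algebra.Properties.CommutativeSemigroup +-commutativeSemigroup public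
    using () renaming (interchange to +-interchange)
  open import Algebra.Properties.CommutativeSemigroup *-commutativeSemigroup public
    using () renaming (x∙yz≈y∙xz to *-swapˡ)

  [_] : ℕ → Carrier
  [ n ] = natCast R n

  -- [ n ] is the library's iterated sum n × 1#, whose homomorphism laws we reuse.
  [n]≡n×1 : ∀ n → [ n ] ≡ n × 1#
  [n]≡n×1 zero = ≡.refl
  [n]≡n×1 (suc n) = ≡.cong (1# +_) ([n]≡n×1 n)

  [+] : ∀ m n → [ m Nat.+ n ] ≈ [ m ] + [ n ]
  [+] m n rewrite [n]≡n×1 (m Nat.+ n) | [n]≡n×1 m | [n]≡n×1 n = ×-homo-+ 1# m n

  [*] : ∀ m n → [ m Nat.* n ] ≈ [ m ] * [ n ]
  [*] m n rewrite [n]≡n×1 (m Nat.* n) | [n]≡n×1 m | [n]≡n×1 n = ×1-homo-* m n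

  [≡] : ∀ {m n} → m ≡ n → [ m ] ≈ [ n ]
  [≡] ≡.refl = refl

  [+]*x : ∀ m n x → [ m Nat.+ n ] * x ≈ [ m ] * x + [ n ] * x
  [+]*x m n x = trans (*-congʳ ([+] m n)) (distribʳ x [ m ] [ n ])

  [*]*x : ∀ m n x → [ m Nat.* n ] * x ≈ [ m ] * ([ n ] * x)
  [*]*x m n x = trans (*-congʳ ([*] m n)) (*-assoc [ m ] [ n ] x)

  x*[1+n] : ∀ x n → x * [ suc n ] ≈ x + x * [ n ]
  x*[1+n] x n = trans (distribˡ x 1# [ n ]) (+-congʳ (*-identityʳ x))

  [1]*x : ∀ x → [ 1 ] * x ≈ x
  [1]*x x = trans (*-congʳ (+-identityʳ 1#)) (*-identityˡ x)

  [2]*x : ∀ x → [ 2 ] * x ≈ x + x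
  [2]*x x = trans ([+]*x 1 1 x) (+-cong ([1]*x x) ([1]*x x))

  [n]≉0 : ∀ n → 1 ≤ n → ¬ [ n ] ≈ 0#
  [n]≉0 (suc n) _ = charZero n

  *-cancelʳ-≉0 : ∀ {x y} z → ¬ z ≈ 0# → x * z ≈ y * z → x ≈ y
  *-cancelʳ-≉0 {x} {y} z z≉0 xz≈yz with noZeroDivisors (x - y) z (begin
      (x - y) * z       ≈⟨ [y-z]x≈yx-zx z x y ⟩
      x * z - y * z     ≈⟨ +-congʳ xz≈yz ⟩
      y * z - y * z     ≈⟨ -‿inverseʳ _ ⟩
      0# ∎)
  ... | inj₁ x-y≈0 = x∙y⁻¹≈ε⇒x≈y x y x-y≈0
  ... | inj₂ z≈0 = ⊥-elim (z≉0 z≈0)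

  [n]-cancelˡ : ∀ {x y} n → 1 ≤ n → [ n ] * x ≈ [ n ] * y → x ≈ y
  [n]-cancelˡ {x} {y} n 1≤n nx≈ny =
    *-cancelʳ-≉0 [ n ] ([n]≉0 n 1≤n) (trans (*-comm x _) (trans nx≈ny (*-comm _ y)))

  [n]*x≈0⇒x≈0 : ∀ n {x} → 1 ≤ n → [ n ] * x ≈ 0# → x ≈ 0#
  [n]*x≈0⇒x≈0 n 1≤n nx≈0 with noZeroDivisors [ n ] _ nx≈0
  ... | inj₁ n≈0 = ⊥-elim ([n]≉0 n 1≤n n≈0)
  ... | inj₂ x≈0 = x≈0

  square≈multiple : ∀ x a → x * x ≈ a * x → (x ≈ 0#) ⊎ (x ≈ a)
  square≈multiple x a x²≈ax with noZeroDivisors x (x - a) (begin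
      x * (x - a)     ≈⟨ x[y-z]≈xy-xz x x a ⟩
      x * x - x * a   ≈⟨ +-congˡ (-‿cong (trans (*-comm x a) (sym x²≈ax))) ⟩
      x * x - x * x   ≈⟨ -‿inverseʳ _ ⟩
      0# ∎)
  ... | inj₁ x≈0 = inj₁ x≈0
  ... | inj₂ x-a≈0 = inj₂ (x∙y⁻¹≈ε⇒x≈y x a x-a≈0)

module Additive {c ℓ : Level} (R : CommutativeRing c ℓ)
  (noZeroDivisors : NoZeroDivisors R) (charZero : CharZero R)
  (k : ℕ) (3≤k : 3 ≤ k)
  (f : ℕ → CommutativeRing.Carrier R) (multiplicative : Multiplicative R f)
  (additive : ∀ (a : Fin k → ℕ) → (∀ i → 1 ≤ a i) →
    CommutativeRing._≈_ R (f (sumℕ k (λ i → a i ^ 2))) (sumR R k (λ i → f (a i ^ 2))))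
  where

  import Data.Nat as Nat
  open Nat using (zero; suc; _<_; z≤n; s≤s)
  import Data.Nat.Properties as Natₚ
  import Data.Fin as Fin
  open import Data.List using (List; []; _∷_; length; replicate; _++_; map; lookup)
  open import Data.List.Properties using (length-++; length-replicate; length-map)
  open import Data.List.Relation.Unary.All using (All; []; _∷_)
  open import Data.List.Relation.Unary.All.Properties using (++⁺; replicate⁺)
  open import Data.Product using (_,_; proj₁; proj₂)
  open import Data.Sum using (_⊎_; inj₁; inj₂)
  open import Data.Empty using (⊥; ⊥-elim)
  open import Relation.Binary.PropositionalEquality as ≡ using (_≡_)
  open import Data.Nat.Coprimality using (Coprime; coprime?)
  open import Relation.Nullary.Decidable using (True; toWitness)
  open import Data.Nat.Induction using (<-rec)
  open CommutativeRing R
  open import Relation.Binary.Reasoning.Setoid setoid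
  open IntegralDomain R noZeroDivisors charZero
  open Arithmetic using (positive-*; evenOrOdd; oddIdentity; evenIdentity; oddShift; twoApart; twoApart′)

  f-cong : ∀ {m n} → m ≡ n → f m ≈ f n
  f-cong ≡.refl = refl

  f-* : ∀ m n → 1 ≤ m → 1 ≤ n → Coprime m n → f (m Nat.* n) ≈ f m * f n
  f-* = proj₂ multiplicative

  F : ℕ → Carrier
  F x = f (x Nat.* x)

  F1≈1 : F 1 ≈ 1#
  F1≈1 = proj₁ multiplicative

  -- The statement's x ^ 2 unfolds to x * (x * 1); we work with x * x throughout.
  x²≡x*x : ∀ x → x ^ 2 ≡ x Nat.* x
  x²≡x*x x = ≡.cong (x Nat.*_) (Natₚ.*-identityʳ x)

  sumSq : List ℕ → ℕ
  sumSq [] = 0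
  sumSq (x ∷ xs) = x Nat.* x Nat.+ sumSq xs

  sumOf : (ℕ → Carrier) → List ℕ → Carrier
  sumOf G [] = 0#
  sumOf G (x ∷ xs) = G x + sumOf G xs

  Positive : List ℕ → Set
  Positive = All (1 ≤_)

  sumSq-++ : ∀ A B → sumSq (A ++ B) ≡ sumSq A Nat.+ sumSq B
  sumSq-++ [] B = ≡.refl
  sumSq-++ (x ∷ A) B = ≡.trans (≡.cong (x Nat.* x Nat.+_) (sumSq-++ A B)) (≡.sym (Natₚ.+-assoc (x Nat.* x) _ _))

  sumOf-++ : ∀ G A B → sumOf G (A ++ B) ≈ sumOf G A + sumOf G B
  sumOf-++ G [] B = sym (+-identityˡ _)
  sumOf-++ G (x ∷ A) B = trans (+-congˡ (sumOf-++ G A B)) (sym (+-assoc _ _ _))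

  ones : ℕ → List ℕ
  ones j = replicate j 1

  sumSq-ones : ∀ j → sumSq (ones j) ≡ j
  sumSq-ones zero = ≡.refl
  sumSq-ones (suc j) = ≡.cong suc (sumSq-ones j)

  sumF-ones : ∀ j → sumOf F (ones j) ≈ [ j ]
  sumF-ones zero = refl
  sumF-ones (suc j) = +-cong F1≈1 (sumF-ones j)

  positive-ones : ∀ j → Positive (ones j)
  positive-ones j = replicate⁺ j (s≤s z≤n)

  additiveOnLists : ∀ L → length L ≡ k → Positive L → f (sumSq L) ≈ sumOf F L
  additiveOnLists L ≡.refl posL = begin
      f (sumSq L)                                     ≈⟨ f-cong (≡.sym (sumℕ≡sumSq L)) ⟩
      f (sumℕ (length L) (λ i → lookup L i ^ 2))      ≈⟨ additive (lookup L) (positiveAt posL) ⟩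
      sumR R (length L) (λ i → f (lookup L i ^ 2))    ≈⟨ sumR≈sumOf L ⟩
      sumOf F L ∎
    where
    sumℕ≡sumSq : ∀ L → sumℕ (length L) (λ i → lookup L i ^ 2) ≡ sumSq L
    sumℕ≡sumSq [] = ≡.refl
    sumℕ≡sumSq (x ∷ L) = ≡.cong₂ Nat._+_ (x²≡x*x x) (sumℕ≡sumSq L)
    sumR≈sumOf : ∀ L → sumR R (length L) (λ i → f (lookup L i ^ 2)) ≈ sumOf F L
    sumR≈sumOf [] = refl
    sumR≈sumOf (x ∷ L) = +-cong (f-cong (x²≡x*x x)) (sumR≈sumOf L)
    positiveAt : ∀ {L} → Positive L → ∀ i → 1 ≤ lookup L i
    positiveAt (1≤x ∷ _) Fin.zero = 1≤x
    positiveAt (_ ∷ posL) (Fin.suc i) = positiveAt posL i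

  -- Padding with 1² = 1 (where F 1 = 1) extends additivity to lists of length ≤ k.
  additivePadded : ∀ L → length L ≤ k → Positive L →
    f (sumSq L Nat.+ (k Nat.∸ length L)) ≈ sumOf F L + [ k Nat.∸ length L ]
  additivePadded L len≤k posL = begin
      f (sumSq L Nat.+ j)          ≈⟨ f-cong (≡.trans (≡.cong (sumSq L Nat.+_) (≡.sym (sumSq-ones j)))
                                                      (≡.sym (sumSq-++ L (ones j)))) ⟩
      f (sumSq (L ++ ones j))      ≈⟨ additiveOnLists (L ++ ones j) length≡k
                                       (++⁺ posL (positive-ones j)) ⟩
      sumOf F (L ++ ones j)        ≈⟨ sumOf-++ F L (ones j) ⟩
      sumOf F L + sumOf F (ones j) ≈⟨ +-congˡ (sumF-ones j) ⟩
      sumOf F L + [ j ] ∎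
    where
    j = k Nat.∸ length L
    length≡k : length (L ++ ones j) ≡ k
    length≡k = ≡.trans (length-++ L) (≡.trans (≡.cong (length L Nat.+_) (length-replicate j))
                                                (Natₚ.m+[n∸m]≡n len≤k))

  sameSquareSum : ∀ A B → length A ≡ length B → length A ≤ k → Positive A → Positive B →
    sumSq A ≡ sumSq B → sumOf F A ≈ sumOf F B
  sameSquareSum A B lenA≡lenB lenA≤k posA posB sqA≡sqB = +-cancelʳ [ k Nat.∸ length A ] _ _ (begin
    sumOf F A + [ k Nat.∸ length A ]        ≈⟨ sym (additivePadded A lenA≤k posA) ⟩
    f (sumSq A Nat.+ (k Nat.∸ length A))    ≈⟨ f-cong (≡.cong₂ (λ u v → u Nat.+ (k Nat.∸ v)) sqA≡sqB lenA≡lenB) ⟩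
    f (sumSq B Nat.+ (k Nat.∸ length B))    ≈⟨ additivePadded B (≡.subst (Nat._≤ k) lenA≡lenB lenA≤k) posB ⟩
    sumOf F B + [ k Nat.∸ length B ]        ≈⟨ +-congˡ ([≡] (≡.cong (k Nat.∸_) (≡.sym lenA≡lenB))) ⟩
    sumOf F B + [ k Nat.∸ length A ] ∎)

  module ThreeTermIdentities where
    open Nat using (NonZero; >-nonZero⁻¹)

    triple : ∀ x y z u v w → .{{_ : NonZero x}} → .{{_ : NonZero y}} → .{{_ : NonZero z}} →
      .{{_ : NonZero u}} → .{{_ : NonZero v}} → .{{_ : NonZero w}} →
      sumSq (x ∷ y ∷ z ∷ []) ≡ sumSq (u ∷ v ∷ w ∷ []) →
      sumOf F (x ∷ y ∷ z ∷ []) ≈ sumOf F (u ∷ v ∷ w ∷ [])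
    triple x y z u v w = sameSquareSum _ _ ≡.refl 3≤k
      (>-nonZero⁻¹ x ∷ >-nonZero⁻¹ y ∷ >-nonZero⁻¹ z ∷ [])
      (>-nonZero⁻¹ u ∷ >-nonZero⁻¹ v ∷ >-nonZero⁻¹ w ∷ [])

    Agree : (ℕ → Carrier) → List ℕ → Set ℓ
    Agree G = All (λ x → F x ≈ G x)

    sumOf-agree : ∀ G {L} → Agree G L → sumOf F L ≈ sumOf G L
    sumOf-agree G [] = refl
    sumOf-agree G (Fx≈Gx ∷ agree) = +-cong Fx≈Gx (sumOf-agree G agree)

    agreeVia : ∀ G z y u v w → .{{_ : NonZero z}} → .{{_ : NonZero y}} →
      .{{_ : NonZero u}} → .{{_ : NonZero v}} → .{{_ : NonZero w}} →
      sumSq (z ∷ y ∷ 1 ∷ []) ≡ sumSq (u ∷ v ∷ w ∷ []) →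
      sumOf G (z ∷ y ∷ 1 ∷ []) ≈ sumOf G (u ∷ v ∷ w ∷ []) →
      Agree G (y ∷ 1 ∷ []) → Agree G (u ∷ v ∷ w ∷ []) → F z ≈ G z
    agreeVia G z y u v w identity G-identity agree-y1 agree-uvw =
      +-cancelʳ (sumOf F (y ∷ 1 ∷ [])) _ _ (begin
        F z + sumOf F (y ∷ 1 ∷ [])    ≈⟨ triple z y 1 u v w identity ⟩
        sumOf F (u ∷ v ∷ w ∷ [])      ≈⟨ sumOf-agree G agree-uvw ⟩
        sumOf G (u ∷ v ∷ w ∷ [])      ≈⟨ G-identity ⟨
        G z + sumOf G (y ∷ 1 ∷ [])    ≈⟨ +-congˡ (sumOf-agree G agree-y1) ⟨
        G z + sumOf F (y ∷ 1 ∷ []) ∎)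

  open ThreeTermIdentities

  -- Put e = F 3 − 1 and Ge x = 1 + e·(x² − 1)/8.
  -- Ge satisfies every identity between equally long lists of odd numbers with equal
  -- sums of squares, so a chain of such identities gives F = Ge on 1, 3, …, 15;
  -- then F 15 = F 3 · F 5 forces e² = 8e, i.e. e = 0 or e = 8.
  module OddSquares where
    open import Data.Nat.ListAction using (sum)
    open import Data.Nat.DivMod using (_/_)

    e : Carrier
    e = F 3 - 1#

    T : ℕ → ℕ
    T x = (x Nat.* x Nat.∸ 1) / 8

    Ge : ℕ → Carrier
    Ge x = 1# + [ T x ] * e

    Ge-sum : ∀ L → sumOf Ge L ≈ [ length L ] + [ sum (map T L) ] * e
    Ge-sum [] = sym (trans (+-identityˡ _) (zeroˡ e))
    Ge-sum (x ∷ L) = begin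
      (1# + [ T x ] * e) + sumOf Ge L                              ≈⟨ +-congˡ (Ge-sum L) ⟩
      (1# + [ T x ] * e) + ([ length L ] + [ sum (map T L) ] * e)  ≈⟨ +-interchange _ _ _ _ ⟩
      (1# + [ length L ]) + ([ T x ] * e + [ sum (map T L) ] * e)  ≈⟨ +-congˡ ([+]*x (T x) _ e) ⟨
      [ suc (length L) ] + [ sum (map T (x ∷ L)) ] * e ∎

    Ge-respects : ∀ A B → length A ≡ length B → sum (map T A) ≡ sum (map T B) →
      sumOf Ge A ≈ sumOf Ge B
    Ge-respects A B lenA≡lenB TA≡TB = begin
      sumOf Ge A                                ≈⟨ Ge-sum A ⟩
      [ length A ] + [ sum (map T A) ] * e      ≈⟨ +-cong ([≡] lenA≡lenB) (*-congʳ ([≡] TA≡TB)) ⟩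
      [ length B ] + [ sum (map T B) ] * e      ≈⟨ Ge-sum B ⟨
      sumOf Ge B ∎

    F≈Ge-1 : F 1 ≈ Ge 1
    F≈Ge-1 = trans F1≈1 (sym (trans (+-congˡ (zeroˡ e)) (+-identityʳ 1#)))

    Ge3≈1+e : Ge 3 ≈ 1# + e
    Ge3≈1+e = +-congˡ ([1]*x e)

    F≈Ge-3 : F 3 ≈ Ge 3
    F≈Ge-3 = sym (begin
      1# + [ 1 ] * e       ≈⟨ Ge3≈1+e ⟩
      1# + (F 3 - 1#)      ≈⟨ +-comm _ _ ⟩
      (F 3 - 1#) + 1#      ≈⟨ +-assoc _ _ _ ⟩
      F 3 + (- 1# + 1#)    ≈⟨ +-congˡ (-‿inverseˡ 1#) ⟩
      F 3 + 0#             ≈⟨ +-identityʳ _ ⟩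
      F 3 ∎)

    oddStep : ∀ z u v w → .{{_ : Nat.NonZero z}} →
      .{{_ : Nat.NonZero u}} → .{{_ : Nat.NonZero v}} → .{{_ : Nat.NonZero w}} →
      sumSq (z ∷ 1 ∷ 1 ∷ []) ≡ sumSq (u ∷ v ∷ w ∷ []) →
      sum (map T (z ∷ 1 ∷ 1 ∷ [])) ≡ sum (map T (u ∷ v ∷ w ∷ [])) →
      Agree Ge (u ∷ v ∷ w ∷ []) → F z ≈ Ge z
    oddStep z u v w identity T-identity = agreeVia Ge z 1 u v w identity
      (Ge-respects (z ∷ 1 ∷ 1 ∷ []) (u ∷ v ∷ w ∷ []) ≡.refl T-identity) (F≈Ge-1 ∷ F≈Ge-1 ∷ [])

    F≈Ge-5 : F 5 ≈ Ge 5
    F≈Ge-5 = oddStep 5 3 3 3 ≡.refl ≡.refl (F≈Ge-3 ∷ F≈Ge-3 ∷ F≈Ge-3 ∷ [])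

    F≈Ge-7 : F 7 ≈ Ge 7
    F≈Ge-7 = oddStep 7 5 5 1 ≡.refl ≡.refl (F≈Ge-5 ∷ F≈Ge-5 ∷ F≈Ge-1 ∷ [])

    F≈Ge-9 : F 9 ≈ Ge 9
    F≈Ge-9 = oddStep 9 3 5 7 ≡.refl ≡.refl (F≈Ge-3 ∷ F≈Ge-5 ∷ F≈Ge-7 ∷ [])

    F≈Ge-11 : F 11 ≈ Ge 11
    F≈Ge-11 = oddStep 11 5 7 7 ≡.refl ≡.refl (F≈Ge-5 ∷ F≈Ge-7 ∷ F≈Ge-7 ∷ [])

    F≈Ge-15 : F 15 ≈ Ge 15
    F≈Ge-15 = oddStep 15 5 9 11 ≡.refl ≡.refl (F≈Ge-5 ∷ F≈Ge-9 ∷ F≈Ge-11 ∷ [])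

    -- (1 + e)(1 + 3e) = F 3 · F 5 = F 15 = 1 + 28e, hence 3e² = 24e.
    e²≈8e : e * e ≈ [ 8 ] * e
    e²≈8e = [n]-cancelˡ 3 (s≤s z≤n) (+-cancelˡ (1# + [ 4 ] * e) _ _ (begin
      (1# + [ 4 ] * e) + [ 3 ] * (e * e)          ≈⟨ +-cong (+-congˡ ([+]*x 1 3 e)) (sym (*-swapˡ e _ e)) ⟩
      (1# + ([ 1 ] * e + [ 3 ] * e)) + e * ([ 3 ] * e)
                                                  ≈⟨ +-congʳ (+-congˡ (+-congʳ ([1]*x e))) ⟩
      (1# + (e + [ 3 ] * e)) + e * ([ 3 ] * e)    ≈⟨ expand e ([ 3 ] * e) ⟨
      (1# + e) * (1# + [ 3 ] * e)                 ≈⟨ *-cong (trans F≈Ge-3 Ge3≈1+e) F≈Ge-5 ⟨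
      F 3 * F 5                                   ≈⟨ f-* 9 25 (s≤s z≤n) (s≤s z≤n) 9⊥25 ⟨
      F 15                                        ≈⟨ F≈Ge-15 ⟩
      1# + [ 4 Nat.+ 3 Nat.* 8 ] * e              ≈⟨ +-congˡ (trans ([+]*x 4 (3 Nat.* 8) e) (+-congˡ ([*]*x 3 8 e))) ⟩
      1# + ([ 4 ] * e + [ 3 ] * ([ 8 ] * e))      ≈⟨ +-assoc _ _ _ ⟨
      (1# + [ 4 ] * e) + [ 3 ] * ([ 8 ] * e) ∎))
      where
      9⊥25 : Coprime 9 25
      9⊥25 = toWitness {a? = coprime? 9 25} _
      expand : ∀ a b → (1# + a) * (1# + b) ≈ (1# + (a + b)) + a * b
      expand a b = begin
        (1# + a) * (1# + b)            ≈⟨ distribʳ (1# + b) 1# a ⟩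
        1# * (1# + b) + a * (1# + b)   ≈⟨ +-cong (*-identityˡ _) (distribˡ a 1# b) ⟩
        (1# + b) + (a * 1# + a * b)    ≈⟨ +-congˡ (+-congʳ (*-identityʳ a)) ⟩
        (1# + b) + (a + a * b)         ≈⟨ +-assoc 1# b _ ⟩
        1# + (b + (a + a * b))         ≈⟨ +-congˡ (+-assoc b a _) ⟨
        1# + ((b + a) + a * b)         ≈⟨ +-congˡ (+-congʳ (+-comm b a)) ⟩
        1# + ((a + b) + a * b)         ≈⟨ +-assoc _ _ _ ⟨
        (1# + (a + b)) + a * b ∎

    e≈0⊎e≈8 : (e ≈ 0#) ⊎ (e ≈ [ 8 ])
    e≈0⊎e≈8 = square≈multiple e [ 8 ] e²≈8e

  open OddSquares using (e; Ge; F≈Ge-3; F≈Ge-5; e≈0⊎e≈8)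

  -- Step 2.  F is determined by F 1, …, F 4: a function G agreeing with F there and
  -- satisfying the identities below (for 5, 6, 8, 10 and for the families 2t + 7 and
  -- 2t + 12) agrees with F everywhere.  By strong induction, each n ≥ 5 is the largest
  -- term of one of these identities, which is solved for it with agreeVia.
  module Determined (G : ℕ → Carrier)
    (agree-1 : F 1 ≈ G 1) (agree-2 : F 2 ≈ G 2) (agree-3 : F 3 ≈ G 3) (agree-4 : F 4 ≈ G 4)
    (G-5 : sumOf G (5 ∷ 1 ∷ 1 ∷ []) ≈ sumOf G (3 ∷ 3 ∷ 3 ∷ []))
    (G-6 : sumOf G (6 ∷ 1 ∷ 1 ∷ []) ≈ sumOf G (2 ∷ 3 ∷ 5 ∷ []))
    (G-8 : sumOf G (8 ∷ 1 ∷ 1 ∷ []) ≈ sumOf G (4 ∷ 7 ∷ 1 ∷ []))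
    (G-10 : sumOf G (10 ∷ 1 ∷ 1 ∷ []) ≈ sumOf G (2 ∷ 7 ∷ 7 ∷ []))
    (G-odd : ∀ t → sumOf G ((7 Nat.+ (t Nat.+ t)) ∷ (1 Nat.+ t) ∷ 1 ∷ [])
                 ≈ sumOf G ((5 Nat.+ (t Nat.+ t)) ∷ (5 Nat.+ t) ∷ 1 ∷ []))
    (G-even : ∀ t → sumOf G ((12 Nat.+ (t Nat.+ t)) ∷ (1 Nat.+ t) ∷ 1 ∷ [])
                  ≈ sumOf G ((8 Nat.+ (t Nat.+ t)) ∷ (9 Nat.+ t) ∷ 1 ∷ []))
    where
    Below : ℕ → Set ℓ
    Below n = ∀ {m} → m < n → 1 ≤ m → F m ≈ G m

    lit< : ∀ m n → {True (m Nat.<? n)} → m < n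
    lit< m n {m<n} = toWitness m<n

    oddCase : ∀ n t → n ≡ 7 Nat.+ (t Nat.+ t) → Below n → F n ≈ G n
    oddCase _ t ≡.refl below = agreeVia G (7 Nat.+ (t Nat.+ t)) (1 Nat.+ t) (5 Nat.+ (t Nat.+ t)) (5 Nat.+ t) 1
      (oddIdentity t) (G-odd t)
      (below (s≤s (s≤s (Natₚ.≤-trans (Natₚ.m≤m+n t t) (Natₚ.m≤n+m (t Nat.+ t) 5)))) (s≤s z≤n) ∷ agree-1 ∷ [])
      (below (Natₚ.+-monoˡ-< (t Nat.+ t) (lit< 5 7)) (s≤s z≤n)
       ∷ below (Natₚ.+-mono-<-≤ (lit< 5 7) (Natₚ.m≤m+n t t)) (s≤s z≤n) ∷ agree-1 ∷ [])

    evenCase : ∀ t → Below (12 Nat.+ (t Nat.+ t)) → F (12 Nat.+ (t Nat.+ t)) ≈ G (12 Nat.+ (t Nat.+ t))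
    evenCase t below = agreeVia G (12 Nat.+ (t Nat.+ t)) (1 Nat.+ t) (8 Nat.+ (t Nat.+ t)) (9 Nat.+ t) 1
      (evenIdentity t) (G-even t)
      (below (Natₚ.+-mono-<-≤ (lit< 1 12) (Natₚ.m≤m+n t t)) (s≤s z≤n) ∷ agree-1 ∷ [])
      (below (Natₚ.+-monoˡ-< (t Nat.+ t) (lit< 8 12)) (s≤s z≤n)
       ∷ below (Natₚ.+-mono-<-≤ (lit< 9 12) (Natₚ.m≤m+n t t)) (s≤s z≤n) ∷ agree-1 ∷ [])

    step : ∀ n → Below n → 1 ≤ n → F n ≈ G n
    step 1 below _ = agree-1
    step 2 below _ = agree-2
    step 3 below _ = agree-3
    step 4 below _ = agree-4
    step 5 below _ = agreeVia G 5 1 3 3 3 ≡.refl G-5 (agree-1 ∷ agree-1 ∷ []) (agree-3 ∷ agree-3 ∷ agree-3 ∷ [])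
    step 6 below _ = agreeVia G 6 1 2 3 5 ≡.refl G-6 (agree-1 ∷ agree-1 ∷ [])
      (agree-2 ∷ agree-3 ∷ below (lit< 5 6) (s≤s z≤n) ∷ [])
    step 7 below _ = oddCase 7 0 ≡.refl below
    step 8 below _ = agreeVia G 8 1 4 7 1 ≡.refl G-8 (agree-1 ∷ agree-1 ∷ [])
      (agree-4 ∷ below (lit< 7 8) (s≤s z≤n) ∷ agree-1 ∷ [])
    step 9 below _ = oddCase 9 1 ≡.refl below
    step 10 below _ = agreeVia G 10 1 2 7 7 ≡.refl G-10 (agree-1 ∷ agree-1 ∷ [])
      (agree-2 ∷ below (lit< 7 10) (s≤s z≤n) ∷ below (lit< 7 10) (s≤s z≤n) ∷ [])
    step 11 below _ = oddCase 11 2 ≡.refl below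
    step (suc (suc (suc (suc (suc (suc (suc (suc (suc (suc (suc (suc m)))))))))))) below _
      with evenOrOdd m
    ... | t , inj₁ ≡.refl = evenCase t below
    ... | t , inj₂ ≡.refl = oddCase _ (3 Nat.+ t) (oddShift t) below

    everywhere : ∀ n → 1 ≤ n → F n ≈ G n
    everywhere = <-rec (λ n → 1 ≤ n → F n ≈ G n) step

  square : ℕ → Carrier
  square n = [ n Nat.* n ]

  sumOf-square : ∀ L → sumOf square L ≈ [ sumSq L ]
  sumOf-square [] = refl
  sumOf-square (x ∷ L) = trans (+-congˡ (sumOf-square L)) (sym ([+] (x Nat.* x) (sumSq L)))

  square-respects : ∀ A B → sumSq A ≡ sumSq B → sumOf square A ≈ sumOf square B
  square-respects A B sqA≡sqB = trans (sumOf-square A) (trans ([≡] sqA≡sqB) (sym (sumOf-square B)))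

  -- Step 3.  If e = 8 then F 3 = 9, F 5 = 25, and F 2 = 4, F 4 = 16 follow from
  -- 6² + 1 + 1 = 2² + 3² + 5² (with F 6 = F 2 · F 3) and 4² + 4² + 1 = 2² + 2² + 5²;
  -- by Step 2, F n = n² for all n ≥ 1.
  module SquaresCase (e≈8 : e ≈ [ 8 ]) where

    F3≈9 : F 3 ≈ [ 9 ]
    F3≈9 = trans F≈Ge-3 (+-congˡ (trans ([1]*x e) e≈8))

    F5≈25 : F 5 ≈ [ 25 ]
    F5≈25 = trans F≈Ge-5 (+-congˡ (trans (*-congˡ e≈8) (sym ([*] 3 8))))

    -- 9·F 2 + 2 = F 6 + 2 = F 2 + 34, i.e. 8·F 2 = 32.
    F2≈4 : F 2 ≈ [ 4 ]
    F2≈4 = *-cancelʳ-≉0 [ 8 ] ([n]≉0 8 (s≤s z≤n)) (+-cancelˡ (F 2) _ _ (+-cancelʳ [ 2 ] _ _ (begin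
      (F 2 + F 2 * [ 8 ]) + [ 2 ]        ≈⟨ +-congʳ (x*[1+n] (F 2) 8) ⟨
      F 2 * [ 9 ] + [ 2 ]                ≈⟨ +-congʳ (*-congˡ F3≈9) ⟨
      F 2 * F 3 + [ 2 ]                  ≈⟨ +-congʳ (f-* 4 9 (s≤s z≤n) (s≤s z≤n) (toWitness {a? = coprime? 4 9} _)) ⟨
      F 6 + [ 2 ]                        ≈⟨ +-congˡ (sumF-ones 2) ⟨
      sumOf F (6 ∷ 1 ∷ 1 ∷ [])           ≈⟨ triple 6 1 1 2 3 5 ≡.refl ⟩
      F 2 + (F 3 + (F 5 + 0#))           ≈⟨ +-congˡ (+-cong F3≈9 (trans (+-identityʳ _) F5≈25)) ⟩
      F 2 + ([ 9 ] + [ 25 ])             ≈⟨ +-congˡ ([+] 9 25) ⟨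
      F 2 + [ 34 ]                       ≈⟨ +-congˡ (trans ([+] 32 2) (+-congʳ ([*] 4 8))) ⟩
      F 2 + ([ 4 ] * [ 8 ] + [ 2 ])      ≈⟨ +-assoc _ _ _ ⟨
      (F 2 + [ 4 ] * [ 8 ]) + [ 2 ] ∎)))

    -- 2·F 4 + 1 = F 2 + F 2 + F 5 = 33.
    F4≈16 : F 4 ≈ [ 16 ]
    F4≈16 = [n]-cancelˡ 2 (s≤s z≤n) (+-cancelʳ [ 1 ] _ _ (begin
      [ 2 ] * F 4 + [ 1 ]          ≈⟨ +-congʳ ([2]*x (F 4)) ⟩
      (F 4 + F 4) + [ 1 ]          ≈⟨ +-assoc _ _ _ ⟩
      F 4 + (F 4 + [ 1 ])          ≈⟨ +-congˡ (+-congˡ (sumF-ones 1)) ⟨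
      sumOf F (4 ∷ 4 ∷ 1 ∷ [])     ≈⟨ triple 4 4 1 2 2 5 ≡.refl ⟩
      sumOf F (2 ∷ 2 ∷ 5 ∷ [])     ≈⟨ sumOf-agree square {2 ∷ 2 ∷ 5 ∷ []} (F2≈4 ∷ F2≈4 ∷ F5≈25 ∷ []) ⟩
      sumOf square (2 ∷ 2 ∷ 5 ∷ []) ≈⟨ sumOf-square (2 ∷ 2 ∷ 5 ∷ []) ⟩
      [ 33 ]                       ≈⟨ trans ([+] 32 1) (+-congʳ ([*] 2 16)) ⟩
      [ 2 ] * [ 16 ] + [ 1 ] ∎))

    F≈square : ∀ n → 1 ≤ n → F n ≈ square n
    F≈square = Determined.everywhere square
      (trans F1≈1 (sym (+-identityʳ 1#))) F2≈4 F3≈9 F4≈16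
      (square-respects (5 ∷ 1 ∷ 1 ∷ []) (3 ∷ 3 ∷ 3 ∷ []) ≡.refl)
      (square-respects (6 ∷ 1 ∷ 1 ∷ []) (2 ∷ 3 ∷ 5 ∷ []) ≡.refl)
      (square-respects (8 ∷ 1 ∷ 1 ∷ []) (4 ∷ 7 ∷ 1 ∷ []) ≡.refl)
      (square-respects (10 ∷ 1 ∷ 1 ∷ []) (2 ∷ 7 ∷ 7 ∷ []) ≡.refl)
      (λ t → square-respects ((7 Nat.+ (t Nat.+ t)) ∷ (1 Nat.+ t) ∷ 1 ∷ [])
                             ((5 Nat.+ (t Nat.+ t)) ∷ (5 Nat.+ t) ∷ 1 ∷ []) (oddIdentity t))
      (λ t → square-respects ((12 Nat.+ (t Nat.+ t)) ∷ (1 Nat.+ t) ∷ 1 ∷ [])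
                             ((8 Nat.+ (t Nat.+ t)) ∷ (9 Nat.+ t) ∷ 1 ∷ []) (evenIdentity t))

  -- Step 4.  If e = 0 then F 3 = F 5 = 1 and F 4 = F 2, so by Step 2 F is 1 at odd and
  -- F 2 at even arguments.  Identities (i + 3)² = (i + 1)² + … of length k then force
  -- F 2 = 0, and one more identity (depending on k) contradicts characteristic zero.
  module DegenerateCase (e≈0 : e ≈ 0#) where

    Ge≈1 : ∀ n → Ge n ≈ 1#
    Ge≈1 n = trans (+-congˡ (trans (*-congˡ e≈0) (zeroʳ _))) (+-identityʳ 1#)

    F3≈1 : F 3 ≈ 1#
    F3≈1 = trans F≈Ge-3 (Ge≈1 3)

    F5≈1 : F 5 ≈ 1#
    F5≈1 = trans F≈Ge-5 (Ge≈1 5)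

    -- 4² + 4² + 1 = 2² + 2² + 5² with F 5 = F 1 gives 2·F 4 = 2·F 2.
    F4≈F2 : F 4 ≈ F 2
    F4≈F2 = [n]-cancelˡ 2 (s≤s z≤n) (begin
      [ 2 ] * F 4        ≈⟨ [2]*x (F 4) ⟩
      F 4 + F 4          ≈⟨ +-cancelʳ (F 1 + 0#) _ _ (begin
        (F 4 + F 4) + (F 1 + 0#)   ≈⟨ +-assoc _ _ _ ⟩
        sumOf F (4 ∷ 4 ∷ 1 ∷ [])   ≈⟨ triple 4 4 1 2 2 5 ≡.refl ⟩
        sumOf F (2 ∷ 2 ∷ 5 ∷ [])   ≈⟨ +-congˡ (+-congˡ (+-congʳ (trans F5≈1 (sym F1≈1)))) ⟩
        F 2 + (F 2 + (F 1 + 0#))   ≈⟨ +-assoc _ _ _ ⟨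
        (F 2 + F 2) + (F 1 + 0#) ∎) ⟩
      F 2 + F 2          ≈⟨ [2]*x (F 2) ⟨
      [ 2 ] * F 2 ∎)

    parityValue : ℕ → Carrier
    parityValue zero = F 2
    parityValue (suc zero) = 1#
    parityValue (suc (suc n)) = parityValue n

    -- All identities of Step 2 relate lists with equally many odd entries.
    F≈parityValue : ∀ n → 1 ≤ n → F n ≈ parityValue n
    F≈parityValue = Determined.everywhere parityValue F1≈1 refl F3≈1 F4≈F2
      refl refl refl refl (λ _ → refl) (λ _ → refl)

    -- F (i + 3) = F (i + 1): in an identity (i + 3)² = (i + 1)² + Σ rest² of length k,
    -- the values of F on rest sum to zero.
    restVanishes : ∀ i rest → suc (length rest) ≡ k → Positive rest →
      sumSq ((1 Nat.+ i) ∷ rest) ≡ (3 Nat.+ i) Nat.* (3 Nat.+ i) → sumOf F rest ≈ 0#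
    restVanishes i rest length≡k posRest identity = +-cancelˡ (F (1 Nat.+ i)) _ _ (begin
      F (1 Nat.+ i) + sumOf F rest        ≈⟨ additiveOnLists ((1 Nat.+ i) ∷ rest) length≡k (s≤s z≤n ∷ posRest) ⟨
      f (sumSq ((1 Nat.+ i) ∷ rest))      ≈⟨ f-cong identity ⟩
      F (3 Nat.+ i)                       ≈⟨ F≈parityValue (3 Nat.+ i) (s≤s z≤n) ⟩
      parityValue (1 Nat.+ i)             ≈⟨ F≈parityValue (1 Nat.+ i) (s≤s z≤n) ⟨
      F (1 Nat.+ i)                       ≈⟨ +-identityʳ _ ⟨
      F (1 Nat.+ i) + 0# ∎)

    sumSq-twos : ∀ n → sumSq (replicate n 2) ≡ n Nat.* 4
    sumSq-twos zero = ≡.refl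
    sumSq-twos (suc n) = ≡.cong (4 Nat.+_) (sumSq-twos n)

    sumF-twos : ∀ n → sumOf F (replicate n 2) ≈ [ n ] * F 2
    sumF-twos zero = sym (zeroˡ _)
    sumF-twos (suc n) = trans (+-cong (sym (*-identityˡ (F 2))) (sumF-twos n)) (sym (distribʳ _ 1# [ n ]))

    k≡3+j : 3 Nat.+ (k Nat.∸ 3) ≡ k
    k≡3+j = Natₚ.m+[n∸m]≡n 3≤k

    -- (j + 3)² = (j + 1)² + (j + 2)·2² with j + 3 = k gives (j + 2)·F 2 = 0.
    F2≈0 : F 2 ≈ 0#
    F2≈0 = [n]*x≈0⇒x≈0 (2 Nat.+ j) (s≤s z≤n) (trans (sym (sumF-twos (2 Nat.+ j)))
      (restVanishes j (replicate (2 Nat.+ j) 2)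
        (≡.trans (≡.cong suc (length-replicate (2 Nat.+ j))) k≡3+j)
        (replicate⁺ (2 Nat.+ j) (s≤s z≤n))
        (≡.trans (≡.cong ((1 Nat.+ j) Nat.* (1 Nat.+ j) Nat.+_) (sumSq-twos (2 Nat.+ j))) (twoApart j))))
      where j = k Nat.∸ 3

    -- k = 3:  f 33 = f 3 · f 11, but 3 = 1+1+1, 11 = 3²+1+1, 33 = 5²+2²+2² give 1 = 3 · 3.
    k≢3 : 3 ≡ k → ⊥
    k≢3 k≡3 = charZero 7 (+-cancelˡ [ 1 ] _ _ (begin
        [ 1 ] + [ 8 ]      ≈⟨ [+] 1 8 ⟨
        [ 3 Nat.* 3 ]      ≈⟨ [*] 3 3 ⟩
        [ 3 ] * [ 3 ]      ≈⟨ *-cong f3≈3 f11≈3 ⟨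
        f 3 * f 11         ≈⟨ f-* 3 11 (s≤s z≤n) (s≤s z≤n) (toWitness {a? = coprime? 3 11} _) ⟨
        f 33               ≈⟨ f33≈1 ⟩
        [ 1 ]              ≈⟨ +-identityʳ _ ⟨
        [ 1 ] + 0# ∎))
      where
      f3≈3 : f 3 ≈ [ 3 ]
      f3≈3 = trans (additiveOnLists (ones 3) k≡3 (positive-ones 3)) (sumF-ones 3)
      f11≈3 : f 11 ≈ [ 3 ]
      f11≈3 = trans (additiveOnLists (3 ∷ ones 2) k≡3 (s≤s z≤n ∷ positive-ones 2))
                    (+-cong F3≈1 (sumF-ones 2))
      f33≈1 : f 33 ≈ [ 1 ]
      f33≈1 = trans (additiveOnLists (5 ∷ 2 ∷ 2 ∷ []) k≡3 (s≤s z≤n ∷ s≤s z≤n ∷ s≤s z≤n ∷ []))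
                    (+-cong F5≈1 (trans (+-cong F2≈0 (+-congʳ F2≈0)) (trans (+-identityˡ _) (+-identityˡ _))))

    -- k = 4:  F 2 = f (1 + 1 + 1 + 1) = 4.
    k≢4 : 4 ≡ k → ⊥
    k≢4 k≡4 = charZero 3 (begin
      [ 4 ]              ≈⟨ sumF-ones 4 ⟨
      sumOf F (ones 4)   ≈⟨ additiveOnLists (ones 4) k≡4 (positive-ones 4) ⟨
      F 2                ≈⟨ F2≈0 ⟩
      0# ∎)

    -- k = 5:  F 4 = f (3² + 2² + 1 + 1 + 1) = 1 + 0 + 3.
    k≢5 : 5 ≡ k → ⊥
    k≢5 k≡5 = charZero 3 (begin
      [ 4 ]                              ≈⟨ +-congˡ (+-identityˡ _) ⟨
      1# + (0# + [ 3 ])                  ≈⟨ +-cong F3≈1 (+-cong F2≈0 (sumF-ones 3)) ⟨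
      sumOf F (3 ∷ 2 ∷ ones 3)           ≈⟨ additiveOnLists (3 ∷ 2 ∷ ones 3) k≡5
                                              (s≤s z≤n ∷ s≤s z≤n ∷ positive-ones 3) ⟨
      F 4                                ≈⟨ trans F4≈F2 F2≈0 ⟩
      0# ∎)

    -- k = i + 6:  (i + 3)² = (i + 1)² + 4·1² + (i + 1)·2², so 4 + (i + 1)·F 2 = 0.
    k≢6+i : ∀ i → 6 Nat.+ i ≡ k → ⊥
    k≢6+i i k≡6+i = charZero 3 (begin
      [ 4 ]                                  ≈⟨ +-cong F1≈1 (+-cong F1≈1 (+-cong F1≈1 (+-cong F1≈1 rest≈0))) ⟨
      sumOf F (1 ∷ 1 ∷ 1 ∷ 1 ∷ twos)         ≈⟨ restVanishes i (1 ∷ 1 ∷ 1 ∷ 1 ∷ twos)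
          (≡.trans (≡.cong (5 Nat.+_) (length-replicate (1 Nat.+ i))) k≡6+i)
          (s≤s z≤n ∷ s≤s z≤n ∷ s≤s z≤n ∷ s≤s z≤n ∷ replicate⁺ (1 Nat.+ i) (s≤s z≤n))
          (≡.trans (≡.cong (λ s → (1 Nat.+ i) Nat.* (1 Nat.+ i) Nat.+ (4 Nat.+ s)) (sumSq-twos (1 Nat.+ i)))
                   (twoApart′ i)) ⟩
      0# ∎)
      where
      twos = replicate (1 Nat.+ i) 2
      rest≈0 : sumOf F twos ≈ 0#
      rest≈0 = trans (sumF-twos (1 Nat.+ i)) (trans (*-congˡ F2≈0) (zeroʳ _))

    impossible : ⊥
    impossible with k Nat.∸ 3 | k≡3+j
    ... | 0 | k≡3 = k≢3 k≡3
    ... | 1 | k≡4 = k≢4 k≡4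
    ... | 2 | k≡5 = k≢5 k≡5
    ... | suc (suc (suc i)) | k≡6+i = k≢6+i i k≡6+i

  f-square : ∀ n → 1 ≤ n → f (n Nat.* n) ≈ [ n Nat.* n ]
  f-square with e≈0⊎e≈8
  ... | inj₁ e≈0 = ⊥-elim (DegenerateCase.impossible e≈0)
  ... | inj₂ e≈8 = SquaresCase.F≈square e≈8

  -- From the values at squares to f n = n for all n ≥ 1.  The key device: if
  -- n·m is a sum of at most k positive squares, scaling by a square Q² coprime to it
  -- makes it a sum of exactly k positive squares (split one square along a Pythagorean
  -- triple at a time), and multiplicativity then isolates f n.
  module FromSquares (f-square : ∀ n → 1 ≤ n → f (n Nat.* n) ≈ [ n Nat.* n ]) where
    open Arithmetic using (coprimePythagoreanTriple; scaleSquare; splitSquare;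
      coprime-*; coprime-^; coprime-∣; positive-^; prime≥2; smallMultipleAsSquares; oddPowerSquare;
      positive-factorʳ; primeFactor; primePowerPart; primeFreePart<; prime-coprime)
    open import Data.Nat.Primality using (Prime)
    open import Relation.Nullary using (yes; no)
    open import Data.Nat.Tactic.RingSolver using (solve-∀)
    open import Data.Product using (∃-syntax; _×_)
    open import Function using (_∘_)
    import Data.Nat.Divisibility as ∣
    import Data.Nat.Coprimality as Coprimality

    Good : ℕ → Set ℓ
    Good n = f n ≈ [ n ]

    good-1 : Good 1
    good-1 = trans F1≈1 (sym (+-identityʳ 1#))

    good-coprime-* : ∀ a b → 1 ≤ a → 1 ≤ b → Coprime a b → Good a → Good b → Good (a Nat.* b)
    good-coprime-* a b 1≤a 1≤b a⊥b good-a good-b = begin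
      f (a Nat.* b)   ≈⟨ f-* a b 1≤a 1≤b a⊥b ⟩
      f a * f b       ≈⟨ *-cong good-a good-b ⟩
      [ a ] * [ b ]   ≈⟨ [*] a b ⟨
      [ a Nat.* b ] ∎

    good-sumOfK : ∀ L → length L ≡ k → Positive L → Good (sumSq L)
    good-sumOfK L length≡k posL = begin
      f (sumSq L)       ≈⟨ additiveOnLists L length≡k posL ⟩
      sumOf F L         ≈⟨ sumOf-agree square (agree posL) ⟩
      sumOf square L    ≈⟨ sumOf-square L ⟩
      [ sumSq L ] ∎
      where
      agree : ∀ {L} → Positive L → Agree square L
      agree [] = []
      agree (1≤x ∷ posL) = f-square _ 1≤x ∷ agree posL

    positive-sumSq : ∀ {L} → Positive L → 1 ≤ length L → 1 ≤ sumSq L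
    positive-sumSq {x ∷ L} (1≤x ∷ _) _ = Natₚ.≤-trans (positive-* 1≤x 1≤x) (Natₚ.m≤m+n (x Nat.* x) (sumSq L))

    scaled : ℕ → List ℕ → List ℕ
    scaled s = map (s Nat.*_)

    sumSq-scaled : ∀ s L → sumSq (scaled s L) ≡ s Nat.* s Nat.* sumSq L
    sumSq-scaled s [] = ≡.sym (Natₚ.*-zeroʳ (s Nat.* s))
    sumSq-scaled s (a ∷ L) = ≡.trans (≡.cong ((s Nat.* a) Nat.* (s Nat.* a) Nat.+_) (sumSq-scaled s L))
                                    (scaleSquare s a (sumSq L))

    positive-scaled : ∀ {s} → 1 ≤ s → ∀ {L} → Positive L → Positive (scaled s L)
    positive-scaled 1≤s [] = []
    positive-scaled 1≤s (1≤a ∷ posL) = positive-* 1≤s 1≤a ∷ positive-scaled 1≤s posL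

    module Splitting (U V H : ℕ) (H²≡U²+V² : H Nat.* H ≡ U Nat.* U Nat.+ V Nat.* V)
      (1≤U : 1 ≤ U) (1≤V : 1 ≤ V) (1≤H : 1 ≤ H) where

      split : List ℕ → List ℕ
      split [] = []
      split (a ∷ rest) = (U Nat.* a) ∷ (V Nat.* a) ∷ scaled H rest

      sumSq-split : ∀ L → sumSq (split L) ≡ H Nat.* H Nat.* sumSq L
      sumSq-split [] = ≡.sym (Natₚ.*-zeroʳ (H Nat.* H))
      sumSq-split (a ∷ rest) = ≡.trans
        (≡.cong (λ z → (U Nat.* a) Nat.* (U Nat.* a) Nat.+ ((V Nat.* a) Nat.* (V Nat.* a) Nat.+ z))
                (sumSq-scaled H rest))
        (splitSquare U V H a (sumSq rest) H²≡U²+V²)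

      length-split : ∀ L → 1 ≤ length L → length (split L) ≡ suc (length L)
      length-split (a ∷ rest) _ = ≡.cong (λ z → suc (suc z)) (length-map (H Nat.*_) rest)

      positive-split : ∀ {L} → Positive L → Positive (split L)
      positive-split [] = []
      positive-split (1≤a ∷ posL) = positive-* 1≤U 1≤a ∷ positive-* 1≤V 1≤a ∷ positive-scaled 1≤H posL

      splitTimes : ℕ → List ℕ → List ℕ
      splitTimes zero L = L
      splitTimes (suc t) L = split (splitTimes t L)

      length-splitTimes : ∀ t L → 1 ≤ length L → length (splitTimes t L) ≡ t Nat.+ length L
      length-splitTimes zero L _ = ≡.refl
      length-splitTimes (suc t) L nonempty = ≡.trans
        (length-split (splitTimes t L)
          (≡.subst (1 ≤_) (≡.sym (length-splitTimes t L nonempty)) (Natₚ.≤-trans nonempty (Natₚ.m≤n+m _ t))))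
        (≡.cong suc (length-splitTimes t L nonempty))

      positive-splitTimes : ∀ t {L} → Positive L → Positive (splitTimes t L)
      positive-splitTimes zero posL = posL
      positive-splitTimes (suc t) posL = positive-split (positive-splitTimes t posL)

      sumSq-splitTimes : ∀ t L → sumSq (splitTimes t L) ≡ H ^ t Nat.* H ^ t Nat.* sumSq L
      sumSq-splitTimes zero L = ≡.sym (Natₚ.+-identityʳ (sumSq L))
      sumSq-splitTimes (suc t) L = ≡.trans (sumSq-split (splitTimes t L))
        (≡.trans (≡.cong (H Nat.* H Nat.*_) (sumSq-splitTimes t L)) (regroup H (H ^ t) (sumSq L)))
        where
        regroup : ∀ H Q S → H Nat.* H Nat.* (Q Nat.* Q Nat.* S) ≡ (H Nat.* Q) Nat.* (H Nat.* Q) Nat.* S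
        regroup = solve-∀

    padToK : ∀ L → Positive L → 1 ≤ length L → length L ≤ k →
      ∃[ Q ] ∃[ L′ ] (1 ≤ Q × Coprime Q (sumSq L) × length L′ ≡ k × Positive L′ ×
                      sumSq L′ ≡ Q Nat.* Q Nat.* sumSq L)
    padToK L posL nonempty short with coprimePythagoreanTriple (sumSq L) (positive-sumSq posL nonempty)
    ... | U , V , H , H²≡U²+V² , 1≤U , 1≤V , 1≤H , H⊥S =
      H ^ t , splitTimes t L , positive-^ 1≤H t , coprime-^ H⊥S t ,
      ≡.trans (length-splitTimes t L nonempty) (Natₚ.m∸n+n≡m short) ,
      positive-splitTimes t posL , sumSq-splitTimes t L
      where
      open Splitting U V H H²≡U²+V² 1≤U 1≤V 1≤H
      t = k Nat.∸ length L

    record Representation (n : ℕ) : Set ℓ where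
      field
        cofactor      : ℕ
        1≤cofactor    : 1 ≤ cofactor
        coprime       : Coprime n cofactor
        good-cofactor : Good cofactor
        squares       : List ℕ
        positive      : Positive squares
        nonempty      : 1 ≤ length squares
        short         : length squares ≤ k
        sum≡          : sumSq squares ≡ n Nat.* cofactor

    -- Represented numbers are good: with Q from padToK, f (n · Q² m) = n · Q² m, while
    -- multiplicativity gives f (n · Q² m) = f n · Q² · m.
    good-represented : ∀ n → 1 ≤ n → Representation n → Good n
    good-represented n 1≤n rep with padToK squares positive nonempty short
      where open Representation rep
    ... | Q , L′ , 1≤Q , Q⊥S , length≡k , posL′ , sum′≡ =
      *-cancelʳ-≉0 _ ([n]≉0 _ (positive-* 1≤QQ 1≤m) ∘ trans ([*] (Q Nat.* Q) m)) (begin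
        f n * ([ Q Nat.* Q ] * [ m ])      ≈⟨ *-congˡ (*-cong (f-square Q 1≤Q) good-cofactor) ⟨
        f n * (f (Q Nat.* Q) * f m)        ≈⟨ *-congˡ (f-* (Q Nat.* Q) m 1≤QQ 1≤m QQ⊥m) ⟨
        f n * f (Q Nat.* Q Nat.* m)        ≈⟨ f-* n _ 1≤n (positive-* 1≤QQ 1≤m) n⊥QQm ⟨
        f (n Nat.* (Q Nat.* Q Nat.* m))    ≈⟨ f-cong sum′≡nQQm ⟨
        f (sumSq L′)                       ≈⟨ good-sumOfK L′ length≡k posL′ ⟩
        [ sumSq L′ ]                       ≈⟨ [≡] sum′≡nQQm ⟩
        [ n Nat.* (Q Nat.* Q Nat.* m) ]    ≈⟨ trans ([*] n _) (*-congˡ ([*] (Q Nat.* Q) m)) ⟩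
        [ n ] * ([ Q Nat.* Q ] * [ m ]) ∎)
      where
      open Representation rep
      m = cofactor
      1≤m = 1≤cofactor
      1≤QQ = positive-* 1≤Q 1≤Q
      sum′≡nQQm : sumSq L′ ≡ n Nat.* (Q Nat.* Q Nat.* m)
      sum′≡nQQm = ≡.trans sum′≡ (≡.trans (≡.cong (Q Nat.* Q Nat.*_) sum≡) (regroup Q n m))
        where
        regroup : ∀ Q n m → Q Nat.* Q Nat.* (n Nat.* m) ≡ n Nat.* (Q Nat.* Q Nat.* m)
        regroup = solve-∀
      Q⊥nm : Coprime Q (n Nat.* m)
      Q⊥nm = ≡.subst (Coprime Q) sum≡ Q⊥S
      Q⊥n : Coprime Q n
      Q⊥n = coprime-∣ Q⊥nm (∣.m∣m*n m)
      Q⊥m : Coprime Q m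
      Q⊥m = coprime-∣ Q⊥nm (∣.n∣m*n n)
      QQ⊥m : Coprime (Q Nat.* Q) m
      QQ⊥m = coprime-* Q⊥m Q⊥m
      n⊥QQm : Coprime n (Q Nat.* Q Nat.* m)
      n⊥QQm = Coprimality.sym (coprime-* (coprime-* Q⊥n Q⊥n) (Coprimality.sym coprime))

    representSmallPrime : ∀ {p} → Prime p → p ≤ k → Representation p
    representSmallPrime {p} pp p≤k = record
      { cofactor = 1 ; 1≤cofactor = s≤s z≤n ; coprime = Coprimality.sym (Coprimality.1-coprimeTo p)
      ; good-cofactor = good-1 ; squares = ones p ; positive = positive-ones p
      ; nonempty = ≡.subst (1 ≤_) (≡.sym (length-replicate p)) (Natₚ.≤-trans (s≤s z≤n) (prime≥2 pp))
      ; short = ≡.subst (Nat._≤ k) (≡.sym (length-replicate p)) p≤k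
      ; sum≡ = ≡.trans (sumSq-ones p) (≡.sym (Natₚ.*-identityʳ p)) }

    -- A prime p > k is represented as m p = x² + y² + (k − 2)·1² with 0 < m < p, once all
    -- numbers below p are good (zero squares among x, y are dropped).
    representLargePrime : ∀ {p} → Prime p → k < p → (∀ {m} → m < p → 1 ≤ m → Good m) →
      Representation p
    representLargePrime {p} pp k<p below with smallMultipleAsSquares k pp 3≤k k<p
    ... | x , y , m , sum≡mp , 0<m , m<p = record
      { cofactor = m ; 1≤cofactor = 0<m
      ; coprime = Coprimality.prime⇒coprime pp {{Nat.>-nonZero 0<m}} m<p
      ; good-cofactor = below m<p 0<m ; squares = L
      ; positive = ++⁺ (positive-nonzero x) (++⁺ (positive-nonzero y) (positive-ones (k Nat.∸ 2)))
      ; nonempty = ≡.subst (1 ≤_) (≡.sym length-L)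
          (Natₚ.≤-trans (Natₚ.∸-monoˡ-≤ 2 3≤k) (Natₚ.≤-trans (Natₚ.m≤n+m (k Nat.∸ 2) (length (nonzero y)))
                                                            (Natₚ.m≤n+m _ (length (nonzero x)))))
      ; short = ≡.subst (Nat._≤ k) (≡.sym length-L)
          (Natₚ.≤-trans (Natₚ.+-mono-≤ (length-nonzero x) (Natₚ.+-monoˡ-≤ (k Nat.∸ 2) (length-nonzero y)))
                        (Natₚ.≤-reflexive (Natₚ.m+[n∸m]≡n (Natₚ.≤-trans (s≤s (s≤s z≤n)) 3≤k))))
      ; sum≡ = ≡.trans (sumSq-++ (nonzero x) _)
                 (≡.trans (≡.cong₂ Nat._+_ (sumSq-nonzero x)
                            (≡.trans (sumSq-++ (nonzero y) _) (≡.cong₂ Nat._+_ (sumSq-nonzero y) (sumSq-ones (k Nat.∸ 2)))))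
                          (≡.trans sum≡mp (Natₚ.*-comm m p))) }
      where
      nonzero : ℕ → List ℕ
      nonzero zero = []
      nonzero (suc x) = suc x ∷ []
      sumSq-nonzero : ∀ x → sumSq (nonzero x) ≡ x Nat.* x
      sumSq-nonzero zero = ≡.refl
      sumSq-nonzero (suc x) = Natₚ.+-identityʳ _
      positive-nonzero : ∀ x → Positive (nonzero x)
      positive-nonzero zero = []
      positive-nonzero (suc x) = s≤s z≤n ∷ []
      length-nonzero : ∀ x → length (nonzero x) ≤ 1
      length-nonzero zero = z≤n
      length-nonzero (suc x) = s≤s z≤n
      L = nonzero x ++ (nonzero y ++ ones (k Nat.∸ 2))
      length-L : length L ≡ length (nonzero x) Nat.+ (length (nonzero y) Nat.+ (k Nat.∸ 2))
      length-L = ≡.trans (length-++ (nonzero x))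
        (≡.cong (length (nonzero x) Nat.+_) (≡.trans (length-++ (nonzero y))
          (≡.cong (length (nonzero y) Nat.+_) (length-replicate (k Nat.∸ 2)))))

    representPrime : ∀ {p} → Prime p → (∀ {m} → m < p → 1 ≤ m → Good m) → Representation p
    representPrime {p} pp below with p Nat.≤? k
    ... | yes p≤k = representSmallPrime pp p≤k
    ... | no p≰k = representLargePrime pp (Natₚ.≰⇒> p≰k) below

    -- If p is represented, so is every odd power p^(2t+1): scale the squares by p^t.
    representOddPower : ∀ {p} → 1 ≤ p → Representation p → ∀ t → Representation (p ^ suc (t Nat.+ t))
    representOddPower {p} 1≤p rep t = record
      { cofactor = cofactor ; 1≤cofactor = 1≤cofactor
      ; coprime = coprime-^ coprime (suc (t Nat.+ t)) ; good-cofactor = good-cofactor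
      ; squares = scaled (p ^ t) squares ; positive = positive-scaled (positive-^ 1≤p t) positive
      ; nonempty = ≡.subst (1 ≤_) (≡.sym (length-map _ squares)) nonempty
      ; short = ≡.subst (Nat._≤ k) (≡.sym (length-map _ squares)) short
      ; sum≡ = ≡.trans (sumSq-scaled (p ^ t) squares)
                 (≡.trans (≡.cong (p ^ t Nat.* p ^ t Nat.*_) sum≡) (oddPowerSquare p t cofactor)) }
      where open Representation rep

    -- If every number below the prime p is good, every power of p is good: even powers
    -- are squares, odd powers are represented.
    good-primePower : ∀ {p} → Prime p → (∀ {m} → m < p → 1 ≤ m → Good m) → ∀ e → Good (p ^ e)
    good-primePower {p} pp below e with evenOrOdd e
    ... | t , inj₁ ≡.refl = begin
      f (p ^ (t Nat.+ t))          ≈⟨ f-cong (Natₚ.^-distribˡ-+-* p t t) ⟩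
      f (p ^ t Nat.* p ^ t)        ≈⟨ f-square (p ^ t) (positive-^ 1≤p t) ⟩
      [ p ^ t Nat.* p ^ t ]        ≈⟨ [≡] (Natₚ.^-distribˡ-+-* p t t) ⟨
      [ p ^ (t Nat.+ t) ] ∎
      where 1≤p = Natₚ.≤-trans (s≤s z≤n) (prime≥2 pp)
    ... | t , inj₂ ≡.refl =
      good-represented (p ^ suc (t Nat.+ t)) (positive-^ 1≤p (suc (t Nat.+ t))) (representOddPower 1≤p (representPrime pp below) t)
      where 1≤p = Natₚ.≤-trans (s≤s z≤n) (prime≥2 pp)

    good-everywhere : ∀ n → 1 ≤ n → Good n
    good-everywhere = <-rec (λ n → 1 ≤ n → Good n) step
      where
      step : ∀ n → (∀ {m} → m < n → 1 ≤ m → Good m) → 1 ≤ n → Good n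
      step 1 _ _ = good-1
      step n@(suc (suc _)) below 1≤n with primeFactor n (s≤s (s≤s z≤n))
      ... | p , pp , p∣n with primePowerPart pp n 1≤n
      ... | e , r , n≡pᵉr , p∤r = begin
        f n                  ≈⟨ f-cong n≡pᵉr ⟩
        f (p ^ e Nat.* r)    ≈⟨ good-coprime-* (p ^ e) r 1≤pᵉ 1≤r (coprime-^ (prime-coprime pp p∤r) e)
                                  (good-primePower pp (λ m<p → below (Natₚ.<-≤-trans m<p (∣.∣⇒≤ p∣n))) e)
                                  (below (primeFreePart< {e = e} pp p∣n 1≤n n≡pᵉr p∤r) 1≤r) ⟩
        [ p ^ e Nat.* r ]    ≈⟨ [≡] n≡pᵉr ⟨
        [ n ] ∎
        where
        1≤pᵉ : 1 ≤ p ^ e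
        1≤pᵉ = positive-^ (Natₚ.≤-trans (s≤s z≤n) (prime≥2 pp)) e
        1≤r : 1 ≤ r
        1≤r = positive-factorʳ (p ^ e) r (≡.subst (1 ≤_) n≡pᵉr 1≤n)

theorem1 : ∀ {c ℓ : Level} (R : CommutativeRing c ℓ) →
    Nontrivial R → NoZeroDivisors R → CharZero R →
    (k : ℕ) → 3 ≤ k →
    (f : ℕ → CommutativeRing.Carrier R) →
    Multiplicative R f →
    (∀ (a : Fin k → ℕ) → (∀ i → 1 ≤ a i) →
    CommutativeRing._≈_ R (f (sumℕ k (λ i → a i ^ 2))) (sumR R k (λ i → f (a i ^ 2)))) →
    ∀ n → 1 ≤ n → CommutativeRing._≈_ R (f n) (natCast R n)
theorem1 R _ noZeroDivisors charZero k 3≤k f multiplicative additive =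
  FromSquares.good-everywhere f-square
  where open Additive R noZeroDivisors charZero k 3≤k f multiplicative additive
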